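{- Let $g\in\mathcal{E}$ with $g\neq\mathrm{id}_{\omega}$. Then there exists a continuous map $\rho:\mathcal{E}\to\mathcal{E}$ such that for every $f\in\mathcal{E}$, \[\rho(f\circ g)=\rho(f)\circ\mathsf{s}.\]
   Context: $\mathcal{E}$ is the set of strictly increasing (injective, increasing) maps $\omega\to\omega$, with the topology induced by the Baire space $\omega^{\omega}$. $\mathsf{s}\in\mathcal{E}$ is the successor function $\mathsf{s}(n)=n+1$. -}

module Defs where

open import Data.Nat using (ℕ; suc; _<_)
open import Data.Product using (Σ; ∃; _×_; proj₁; _,_)
open import Relation.Binary.PropositionalEquality using (_≡_)

StrictlyIncreasing : (ℕ → ℕ) → Set
StrictlyIncreasing f = ∀ m n → m < n → f m < f n

𝓔 : Set
𝓔 = Σ (ℕ → ℕ) StrictlyIncreasing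

AgreeBelow : ℕ → (ℕ → ℕ) → (ℕ → ℕ) → Set
AgreeBelow m f h = ∀ i → i < m → f i ≡ h i

-- continuity of ρ : 𝓔 → 𝓔 w.r.t. the topology induced from Baire space
Continuous : (𝓔 → 𝓔) → Set
Continuous ρ = ∀ (f : 𝓔) (n : ℕ) → ∃ λ m → ∀ (h : 𝓔) →
  AgreeBelow m (proj₁ f) (proj₁ h) → AgreeBelow n (proj₁ (ρ f)) (proj₁ (ρ h))

infixr 9 _∘𝓔_
_∘𝓔_ : 𝓔 → 𝓔 → 𝓔
(f , pf) ∘𝓔 (g , pg) = (λ n → f (g n)) , λ m n m<n → pf (g m) (g n) (pg m n m<n)

open import Data.Nat using (s≤s)
𝓈 : 𝓔
𝓈 = suc , λ m n m<n → s≤s m<n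

module Submission where

-- Let g ∈ 𝓔 with g k ≠ k for some k.  Since g is strictly
-- increasing it is inflationary (n ≤ g n), hence k < g k, and then every
-- m ≥ k is moved strictly upwards: m < g m.  Consider the forward orbit
--   a 0 = k,   a (n+1) = g (a n).
-- It stays above k, so each step is a strict increase and a ∈ 𝓔.  Put
--   ρ f = f ∘ a.
-- Then ρ (f ∘ g) n = f (g (a n)) = f (a (n+1)) = (ρ f ∘ s) n holds by
-- definition, and ρ is continuous because right composition with any
-- a ∈ 𝓔 is: the first n values of f ∘ a only read f below a n.

open import Defs
open import Data.Nat using (ℕ; zero; suc; _<_; _≤_; z≤n; s≤s; _≤′_; ≤′-refl; ≤′-step)
open import Data.Nat.Properties using (≤-refl; ≤-trans; <-trans; ≤-<-trans; ≤∧≢⇒<; n<1+n; ≤⇒≤′; m≤n⇒m<n∨m≡n)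
open import Data.Nat.GeneralisedArithmetic using (fold)
open import Data.Product using (Σ; ∃; _×_; proj₁; _,_)
open import Data.Sum using (inj₁; inj₂)
open import Relation.Binary.PropositionalEquality using (_≡_; _≢_; refl; sym)

inflationary : ∀ {g : ℕ → ℕ} → StrictlyIncreasing g → ∀ n → n ≤ g n
inflationary g↑ zero    = z≤n
inflationary g↑ (suc n) = ≤-trans (s≤s (inflationary g↑ n)) (g↑ n (suc n) (n<1+n n))

-- If a strictly increasing g moves some m upwards, it moves every n ≥ m
-- upwards: from n < g n we get n + 1 ≤ g n < g (n + 1).
movesUpAbove : ∀ {g : ℕ → ℕ} → StrictlyIncreasing g →
               ∀ {m} → m < g m → ∀ {n} → m ≤′ n → n < g n
movesUpAbove g↑ m<gm ≤′-refl              = m<gm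
movesUpAbove g↑ m<gm (≤′-step {n} m≤′n) =
  ≤-<-trans (movesUpAbove g↑ m<gm m≤′n) (g↑ n (suc n) (n<1+n n))

stepwiseIncreasing : ∀ {a : ℕ → ℕ} → (∀ n → a n < a (suc n)) → StrictlyIncreasing a
stepwiseIncreasing step m (suc n) (s≤s m≤n) with m≤n⇒m<n∨m≡n m≤n
... | inj₁ m<n  = <-trans (stepwiseIncreasing step m n m<n) (step n)
... | inj₂ refl = step m

-- For every a ∈ 𝓔, the map f ↦ f ∘ a is continuous on 𝓔: the first n
-- values of f ∘ a are determined by the first a n values of f.
precompose-continuous : (a : 𝓔) → Continuous (λ f → f ∘𝓔 a)
precompose-continuous (a , a↑) f n =
  a n , λ h f≈h i i<n → f≈h (a i) (a↑ i n i<n)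

-- The forward orbit of k under g, an element of 𝓔 as soon as g ∈ 𝓔
-- moves k.  By construction  orbit (n + 1) = g (orbit n)  definitionally.
module Orbit (g : ℕ → ℕ) (g↑ : StrictlyIncreasing g) (k : ℕ) (gk≢k : g k ≢ k) where

  orbit : ℕ → ℕ
  orbit = fold k g

  aboveStart : ∀ n → k ≤ orbit n
  aboveStart zero    = ≤-refl
  aboveStart (suc n) = ≤-trans (aboveStart n) (inflationary g↑ (orbit n))

  orbit-step : ∀ n → orbit n < orbit (suc n)
  orbit-step n = movesUpAbove g↑ k<gk (≤⇒≤′ (aboveStart n))
    where
    k<gk : k < g k
    k<gk = ≤∧≢⇒< (inflationary g↑ k) (λ k≡gk → gk≢k (sym k≡gk))

  orbit𝓔 : 𝓔
  orbit𝓔 = orbit , stepwiseIncreasing orbit-step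

lemma4p14 : (g : 𝓔) → (∃ λ k → proj₁ g k ≢ k) →
    Σ (𝓔 → 𝓔) λ ρ → Continuous ρ ×
      (∀ (f : 𝓔) (n : ℕ) → proj₁ (ρ (f ∘𝓔 g)) n ≡ proj₁ (ρ f ∘𝓔 𝓈) n)
lemma4p14 (g , g↑) (k , gk≢k) =
  (λ f → f ∘𝓔 orbit𝓔) , precompose-continuous orbit𝓔 , λ f n → refl
  where open Orbit g g↑ k gk≢k
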